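{- If $\Gamma\vdash M:\sigma$ is derivable in $\lambda_{\circledR}\cap$, then for every variable $x$: $x\in Dom(\Gamma)$ if and only if $x\in Fv(M)$.
   Context: Terms. Fix a countably infinite set of variables. The set $\Lambda_{\circledR}$ of terms and $Fv(M)$ are defined simultaneously: every variable $x$ is a term with $Fv(x)=\{x\}$; $\lambda x.M$ is a term if $M$ is a term and $x\in Fv(M)$ ($Fv=Fv(M)\setminus\{x\}$); $MN$ is a term if $M,N$ are terms with $Fv(M)\cap Fv(N)=\emptyset$ ($Fv=Fv(M)\cup Fv(N)$); $x\odot M$ (erasure) is a term if $M$ is a term and $x\notin Fv(M)$ ($Fv=\{x\}\cup Fv(M)$); $x<^{x_1}_{x_2}M$ (duplication) is a term if $M$ is a term, $x_1,x_2\in Fv(M)$, $x_1\neq x_2$, $x\notin Fv(M)\setminus\{x_1,x_2\}$ ($Fv=\{x\}\cup(Fv(M)\setminus\{x_1,x_2\})$). Types. Strict types $\sigma::=p\mid\alpha\to\sigma$; types $\alpha::=\cap_{i=1}^n\sigma_i$ ($=\top$ if $n=0$), with $\cap$ commutative, associative, $\top$ neutral. A basis $\Gamma$ maps a finite set $Dom(\Gamma)$ of variables to types; $\Gamma,x:\alpha$ extends by $x\notin Dom(\Gamma)$; for $Dom(\Gamma)=Dom(\Delta)$, $(\Gamma\sqcap\Delta)(x)=\Gamma(x)\cap\Delta(x)$; $\Gamma^{\top}$ maps $Dom(\Gamma)$ to $\top$. Rules of $\lambda_{\circledR}\cap$: (Ax) $x:\sigma\vdash x:\sigma$; ($\to_I$)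 from $\Gamma,x:\alpha\vdash M:\sigma$ infer $\Gamma\vdash\lambda x.M:\alpha\to\sigma$; ($\to_E$) from $\Gamma\vdash M:\cap_{i=1}^n\tau_i\to\sigma$ and $\Delta_0\vdash N:\tau_0,\dots,\Delta_n\vdash N:\tau_n$ infer $\Gamma,\Delta_0^{\top}\sqcap\Delta_1\sqcap\dots\sqcap\Delta_n\vdash MN:\sigma$; (Cont) from $\Gamma,x:\alpha,y:\beta\vdash M:\sigma$ infer $\Gamma,z:\alpha\cap\beta\vdash z<^{x}_{y}M:\sigma$; (Thin) from $\Gamma\vdash M:\sigma$ infer $\Gamma,x:\top\vdash x\odot M:\sigma$. -}

module Defs where

open import Data.Nat using (ℕ; _≟_)
open import Data.List using (List; []; _∷_; _++_)
open import Data.Maybe using (Maybe; just; nothing)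
open import Data.Bool using (if_then_else_)
open import Data.Product using (_×_; ∃)
open import Data.Sum using (_⊎_)
open import Data.Unit using (⊤)
open import Data.Empty using (⊥)
open import Relation.Nullary using (¬_; does)
open import Relation.Binary.PropositionalEquality using (_≡_; _≢_)

Var : Set
Var = ℕ

data Term : Set where
  var : Var → Term
  lam : Var → Term → Term
  app : Term → Term → Term
  era : Var → Term → Term               -- era x M  =  x ⊙ M
  dup : Var → Var → Var → Term → Term   -- dup x x₁ x₂ M  =  x <^{x₁}_{x₂} M

_∈Fv_ : Var → Term → Set
x ∈Fv var y        = x ≡ y
x ∈Fv lam y M      = x ∈Fv M × x ≢ y
x ∈Fv app M N      = x ∈Fv M ⊎ x ∈Fv N
x ∈Fv era y M      = x ≡ y ⊎ x ∈Fv M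
x ∈Fv dup y y₁ y₂ M = x ≡ y ⊎ (x ∈Fv M × x ≢ y₁ × x ≢ y₂)

WF : Term → Set
WF (var x)          = ⊤
WF (lam x M)        = WF M × x ∈Fv M
WF (app M N)        = WF M × WF N × (∀ x → x ∈Fv M → x ∈Fv N → ⊥)
WF (era x M)        = WF M × ¬ (x ∈Fv M)
WF (dup x x₁ x₂ M)  = WF M × x₁ ∈Fv M × x₂ ∈Fv M × x₁ ≢ x₂
                      × ¬ (x ∈Fv M × x ≢ x₁ × x ≢ x₂)

-- Types: strict types σ ::= p | α → σ ; types α = ∩ of strict types,
-- represented as lists (⊤ = [], ∩ = _++_), taken modulo _≈t_.

data Strict : Set where
  atom : ℕ → Strict
  _⇒_  : List Strict → Strict → Strict

Type : Set
Type = List Strict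

⊤ᵗ : Type
⊤ᵗ = []

-- equivalence: ∩ commutative, associative, ⊤ neutral (at all depths)
mutual
  data _≈s_ : Strict → Strict → Set where
    atom≈ : ∀ {p} → atom p ≈s atom p
    arr≈  : ∀ {α β σ τ} → α ≈t β → σ ≈s τ → (α ⇒ σ) ≈s (β ⇒ τ)

  data _≈t_ : Type → Type → Set where
    []≈    : [] ≈t []
    cons≈  : ∀ {σ τ α β} → σ ≈s τ → α ≈t β → (σ ∷ α) ≈t (τ ∷ β)
    swap≈  : ∀ {σ τ α} → (σ ∷ τ ∷ α) ≈t (τ ∷ σ ∷ α)
    trans≈ : ∀ {α β γ} → α ≈t β → β ≈t γ → α ≈t γ

Basis : Set
Basis = Var → Maybe Type

_∈Dom_ : Var → Basis → Set
x ∈Dom Γ = ∃ λ α → Γ x ≡ just α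

SameDom : Basis → Basis → Set
SameDom Γ Δ = ∀ x → (x ∈Dom Γ → x ∈Dom Δ) × (x ∈Dom Δ → x ∈Dom Γ)

Disjoint : Basis → Basis → Set
Disjoint Γ Δ = ∀ x → x ∈Dom Γ → x ∈Dom Δ → ⊥

single : Var → Type → Basis
single x α y = if does (y ≟ x) then just α else nothing

-- Γ , x : α   (used only when x ∉ Dom Γ)
extend : Basis → Var → Type → Basis
extend Γ x α y = if does (y ≟ x) then just α else Γ y

remove : Basis → Var → Basis
remove Γ x y = if does (y ≟ x) then nothing else Γ y

meetM : Maybe Type → Maybe Type → Maybe Type
meetM (just a) (just b) = just (a ++ b)
meetM _ _ = nothing

-- Γ ⊓ Δ  (used only when Dom Γ = Dom Δ)
_⊓_ : Basis → Basis → Basis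
(Γ ⊓ Δ) y = meetM (Γ y) (Δ y)

topM : Maybe Type → Maybe Type
topM (just _) = just ⊤ᵗ
topM nothing  = nothing

_^⊤ : Basis → Basis
(Γ ^⊤) y = topM (Γ y)

unionM : Maybe Type → Maybe Type → Maybe Type
unionM (just a) _ = just a
unionM nothing  b = b

-- Γ , Δ  (used only when Dom Γ ∩ Dom Δ = ∅)
_,,_ : Basis → Basis → Basis
(Γ ,, Δ) y = unionM (Γ y) (Δ y)

mutual
  data _⊢_∶_ : Basis → Term → Strict → Set where
    Ax   : ∀ {x σ} → single x (σ ∷ []) ⊢ var x ∶ σ
    →I   : ∀ {Γ x α M σ} → Γ x ≡ just α → Γ ⊢ M ∶ σ →
           remove Γ x ⊢ lam x M ∶ (α ⇒ σ)
    -- Δ collects Δ₀^⊤ ⊓ Δ₁ ⊓ … ⊓ Δₙ and β the types τ₁ … τₙ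
    →E   : ∀ {Γ Δ M N α β σ} → Γ ⊢ M ∶ (α ⇒ σ) → Δ ⊢* N ∶ β → β ≈t α →
           Disjoint Γ Δ → (Γ ,, Δ) ⊢ app M N ∶ σ
    Cont : ∀ {Γ x y z α β M σ} → Γ ⊢ M ∶ σ → Γ x ≡ just α → Γ y ≡ just β →
           x ≢ y → remove (remove Γ x) y z ≡ nothing →
           extend (remove (remove Γ x) y) z (α ++ β) ⊢ dup z x y M ∶ σ
    Thin : ∀ {Γ x M σ} → Γ ⊢ M ∶ σ → Γ x ≡ nothing →
           extend Γ x ⊤ᵗ ⊢ era x M ∶ σ

  -- the argument premises Δ₀ ⊢ N : τ₀, Δ₁ ⊢ N : τ₁, …, Δₙ ⊢ N : τₙ of (→E),
  -- with combined basis Δ₀^⊤ ⊓ Δ₁ ⊓ … ⊓ Δₙ and type list τ₁ … τₙ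
  data _⊢*_∶_ : Basis → Term → Type → Set where
    base : ∀ {Δ₀ N τ₀} → Δ₀ ⊢ N ∶ τ₀ → (Δ₀ ^⊤) ⊢* N ∶ []
    more : ∀ {Δ Δs N τ β} → Δ ⊢ N ∶ τ → Δs ⊢* N ∶ β → SameDom Δ Δs →
           (Δ ⊓ Δs) ⊢* N ∶ (τ ∷ β)

module Submission where

-- Each rule
-- builds its basis from the premises' bases by one of the basis
-- operations of Defs (singleton, extension, removal, disjoint union,
-- meet, ⊤-erasure), and each clause of Fv mirrors that operation.

open import Defs
open import Data.Nat using (_≟_)
open import Data.List using (_++_)
open import Data.Maybe using (just; nothing)
open import Data.Product using (_×_; _,_; proj₁)
open import Data.Product.Function.NonDependent.Propositional using (_×-⇔_)
open import Data.Sum using (_⊎_; inj₁; inj₂)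
open import Data.Sum.Function.Propositional using (_⊎-⇔_)
open import Data.Empty using (⊥-elim)
open import Relation.Nullary using (yes; no)
open import Relation.Nullary.Decidable using (dec-true; dec-false)
open import Relation.Binary.PropositionalEquality using (_≡_; _≢_; refl)
open import Function.Bundles using (_⇔_; mk⇔; Equivalence)
open import Function.Construct.Identity using (⇔-id)
open import Function.Related.Propositional using (module EquationalReasoning)
open EquationalReasoning

-- A conjunction of a proposition with itself is equivalent to it; this
-- is how the n argument premises of (→E), all about the same N, merge.
×-diagonal : {A : Set} → (A × A) ⇔ A
×-diagonal = mk⇔ proj₁ (λ a → a , a)

-- Re-association of conjunctions, needed to match the nested removals
-- in (Cont) with the flat side conditions in the Fv clause of duplication.
×-assocˡ : {A B C : Set} → ((A × B) × C) ⇔ (A × B × C)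
×-assocˡ = mk⇔ (λ { ((a , b) , c) → a , b , c }) (λ { (a , b , c) → (a , b) , c })

dom-single : ∀ x y α → x ∈Dom single y α ⇔ (x ≡ y)
dom-single x y α with x ≟ y
... | yes x≡y rewrite dec-true (x ≟ y) x≡y = mk⇔ (λ _ → x≡y) (λ _ → α , refl)
... | no  x≢y rewrite dec-false (x ≟ y) x≢y = mk⇔ (λ { (_ , ()) }) (λ x≡y → ⊥-elim (x≢y x≡y))

dom-extend : ∀ Γ x y α → x ∈Dom extend Γ y α ⇔ (x ≡ y ⊎ x ∈Dom Γ)
dom-extend Γ x y α with x ≟ y
... | yes x≡y rewrite dec-true (x ≟ y) x≡y = mk⇔ (λ _ → inj₁ x≡y) (λ _ → α , refl)
... | no  x≢y rewrite dec-false (x ≟ y) x≢y = mk⇔ inj₂ λ { (inj₁ x≡y) → ⊥-elim (x≢y x≡y) ; (inj₂ x∈Γ) → x∈Γ }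

dom-remove : ∀ Γ x y → x ∈Dom remove Γ y ⇔ (x ∈Dom Γ × x ≢ y)
dom-remove Γ x y with x ≟ y
... | yes x≡y rewrite dec-true (x ≟ y) x≡y = mk⇔ (λ { (_ , ()) }) (λ { (_ , x≢y) → ⊥-elim (x≢y x≡y) })
... | no  x≢y rewrite dec-false (x ≟ y) x≢y = mk⇔ (λ x∈Γ → x∈Γ , x≢y) proj₁

dom-union : ∀ Γ Δ x → x ∈Dom (Γ ,, Δ) ⇔ (x ∈Dom Γ ⊎ x ∈Dom Δ)
dom-union Γ Δ x with Γ x
... | just α  = mk⇔ (λ _ → inj₁ (α , refl)) (λ _ → α , refl)
... | nothing = mk⇔ inj₂ λ { (inj₁ (_ , ())) ; (inj₂ x∈Δ) → x∈Δ }

dom-meet : ∀ Γ Δ x → x ∈Dom (Γ ⊓ Δ) ⇔ (x ∈Dom Γ × x ∈Dom Δ)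
dom-meet Γ Δ x with Γ x | Δ x
... | just α  | just β  = mk⇔ (λ _ → (α , refl) , (β , refl)) (λ _ → α ++ β , refl)
... | just _  | nothing = mk⇔ (λ { (_ , ()) }) (λ { (_ , (_ , ())) })
... | nothing | _       = mk⇔ (λ { (_ , ()) }) (λ { ((_ , ()) , _) })

dom-top : ∀ Γ x → x ∈Dom (Γ ^⊤) ⇔ x ∈Dom Γ
dom-top Γ x with Γ x
... | just _  = mk⇔ (λ _ → _ , refl) (λ _ → _ , refl)
... | nothing = mk⇔ (λ { (_ , ()) }) (λ { (_ , ()) })

dom-contract : ∀ Γ x y₁ y₂ z α →
  x ∈Dom extend (remove (remove Γ y₁) y₂) z α ⇔ (x ≡ z ⊎ (x ∈Dom Γ × x ≢ y₁ × x ≢ y₂))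
dom-contract Γ x y₁ y₂ z α = begin
  x ∈Dom extend (remove (remove Γ y₁) y₂) z α
    ∼⟨ dom-extend (remove (remove Γ y₁) y₂) x z α ⟩
  (x ≡ z ⊎ x ∈Dom remove (remove Γ y₁) y₂)
    ∼⟨ ⇔-id _ ⊎-⇔ dom-remove (remove Γ y₁) x y₂ ⟩
  (x ≡ z ⊎ (x ∈Dom remove Γ y₁ × x ≢ y₂))
    ∼⟨ ⇔-id _ ⊎-⇔ (dom-remove Γ x y₁ ×-⇔ ⇔-id _) ⟩
  (x ≡ z ⊎ ((x ∈Dom Γ × x ≢ y₁) × x ≢ y₂))
    ∼⟨ ⇔-id _ ⊎-⇔ ×-assocˡ ⟩
  (x ≡ z ⊎ (x ∈Dom Γ × x ≢ y₁ × x ≢ y₂)) ∎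

mutual
  dom≡fv : ∀ {Γ M σ} → Γ ⊢ M ∶ σ → ∀ x → x ∈Dom Γ ⇔ x ∈Fv M
  dom≡fv (Ax {y}) x = dom-single x y _
  dom≡fv (→I {Γ} {y} _ ⊢M) x = begin
    x ∈Dom remove Γ y        ∼⟨ dom-remove Γ x y ⟩
    (x ∈Dom Γ × x ≢ y)       ∼⟨ dom≡fv ⊢M x ×-⇔ ⇔-id _ ⟩
    (x ∈Fv _ × x ≢ y)        ∎
  dom≡fv (→E {Γ} {Δ} ⊢M ⊢*N _ _) x = begin
    x ∈Dom (Γ ,, Δ)          ∼⟨ dom-union Γ Δ x ⟩
    (x ∈Dom Γ ⊎ x ∈Dom Δ)    ∼⟨ dom≡fv ⊢M x ⊎-⇔ dom≡fv* ⊢*N x ⟩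
    (x ∈Fv _ ⊎ x ∈Fv _)      ∎
  dom≡fv (Cont {Γ} {y₁} {y₂} {z} {α} {β} ⊢M _ _ _ _) x = begin
    x ∈Dom extend (remove (remove Γ y₁) y₂) z (α ++ β)
                                              ∼⟨ dom-contract Γ x y₁ y₂ z (α ++ β) ⟩
    (x ≡ z ⊎ (x ∈Dom Γ × x ≢ y₁ × x ≢ y₂))   ∼⟨ ⇔-id _ ⊎-⇔ (dom≡fv ⊢M x ×-⇔ ⇔-id _) ⟩
    (x ≡ z ⊎ (x ∈Fv _ × x ≢ y₁ × x ≢ y₂))    ∎
  dom≡fv (Thin {Γ} {y} ⊢M _) x = begin
    x ∈Dom extend Γ y ⊤ᵗ     ∼⟨ dom-extend Γ x y ⊤ᵗ ⟩
    (x ≡ y ⊎ x ∈Dom Γ)       ∼⟨ ⇔-id _ ⊎-⇔ dom≡fv ⊢M x ⟩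
    (x ≡ y ⊎ x ∈Fv _)        ∎

  dom≡fv* : ∀ {Δ N β} → Δ ⊢* N ∶ β → ∀ x → x ∈Dom Δ ⇔ x ∈Fv N
  dom≡fv* (base {Δ₀} ⊢N) x = begin
    x ∈Dom (Δ₀ ^⊤)           ∼⟨ dom-top Δ₀ x ⟩
    x ∈Dom Δ₀                ∼⟨ dom≡fv ⊢N x ⟩
    x ∈Fv _                  ∎
  dom≡fv* (more {Δ} {Δs} ⊢N ⊢*N _) x = begin
    x ∈Dom (Δ ⊓ Δs)          ∼⟨ dom-meet Δ Δs x ⟩
    (x ∈Dom Δ × x ∈Dom Δs)   ∼⟨ dom≡fv ⊢N x ×-⇔ dom≡fv* ⊢*N x ⟩
    (x ∈Fv _ × x ∈Fv _)      ∼⟨ ×-diagonal ⟩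
    x ∈Fv _                  ∎

mainTheorem13 : ∀ {Γ M σ} → WF M → Γ ⊢ M ∶ σ →
    ∀ x → (x ∈Dom Γ → x ∈Fv M) × (x ∈Fv M → x ∈Dom Γ)
mainTheorem13 _ ⊢M x = Equivalence.to (dom≡fv ⊢M x) , Equivalence.from (dom≡fv ⊢M x)
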